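{- Let $\Sigma$ be a signature. There exist a nominal $\Sigma$-algebra $\mathcal{A}$, a valuation $\varsigma$ in $\mathcal{A}$, a fixed-point context $\Upsilon$, permutations $\pi,\pi'$ and a variable $X$ such that the judgement $\Upsilon\vdash\pi\curlywedge\pi'\cdot X$ is derivable by the rule $(\curlywedge\mathbf{var})$ (i.e. $\mathrm{dom}(\pi^{\pi'^{ -1}})\subseteq\mathrm{dom}(\mathrm{perm}(\Upsilon|_X))$), but $[\![\Upsilon\vdash\pi\curlywedge\pi'\cdot X]\!]^{\mathcal{A}}_{\varsigma}$ is not valid.
   Context: Atoms $\mathbb{A}$ and variables $\mathbb{V}$ are disjoint countably infinite sets; $\mathrm{Perm}(\mathbb{A})$ is the group of bijections $\pi$ of $\mathbb{A}$ with finite $\mathrm{dom}(\pi)=\{a\mid\pi(a)\ne a\}$; the conjugate is $\pi^{\rho}=\rho\circ\pi\circ\rho^{ -1}$. Nominal terms over $\Sigma$: $t::=a\mid\pi\cdot X\mid[a]t\mid\mathsf{f}(t_1,\ldots,t_n)$. A fixed-point context $\Upsilon$ is a finite set of primitive constraints $\gamma\curlywedge X$; $\mathrm{perm}(\Upsilon|_X)=\{\gamma\mid\gamma\curlywedge X\in\Upsilon\}$ and $\mathrm{dom}(\mathrm{perm}(\Upsilon|_X))=\bigcup_{\gamma\in\mathrm{perm}(\Upsilon|_X)}\mathrm{dom}(\gamma)$. The rule $(\curlywedge\mathbf{var})$ derives $\Upsilon\vdash\pi\curlywedge\pi'\cdot X$ whenever $\mathrm{dom}(\pi^{\pi'^{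 -1}})\subseteq\mathrm{dom}(\mathrm{perm}(\Upsilon|_X))$. A nominal set is a $\mathrm{Perm}(\mathbb{A})$-set whose every element has a finite support. A nominal $\Sigma$-algebra consists of a nominal set $\mathsf{A}$, an equivariant $\mathtt{atom}:\mathbb{A}\to|\mathsf{A}|$, an equivariant $\mathtt{abs}:\mathbb{A}\times|\mathsf{A}|\to|\mathsf{A}|$ with $\{c\mid(a\ c)\cdot\mathtt{abs}(a,x)\ne\mathtt{abs}(a,x)\}$ finite for all $a,x$, and an equivariant $f:|\mathsf{A}|^n\to|\mathsf{A}|$ for each $\mathsf{f}:n\in\Sigma$. A valuation is $\varsigma:\mathbb{V}\to|\mathsf{A}|$, and $[\![\pi\cdot X]\!]_\varsigma=\pi\cdot\varsigma(X)$. $[\![\Upsilon]\!]_\varsigma$ is valid iff $\gamma\cdot\varsigma(X)=\varsigma(X)$ for each $\gamma\curlywedge X\in\Upsilon$; $[\![\Upsilon\vdash\pi\curlywedge t]\!]_\varsigma$ is valid iff validity of $[\![\Upsilon]\!]_\varsigma$ implies $\pi\cdot[\![t]\!]_\varsigma=[\![t]\!]_\varsigma$. -}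

module Defs where

open import Level using (Level; suc; _⊔_)
open import Data.Nat as ℕ using (ℕ; _≟_)
open import Data.List using (List; []; _∷_; _++_)
open import Data.List.Membership.Propositional using (_∈_)
open import Data.List.Membership.Propositional.Properties using (∈-++⁺ˡ; ∈-++⁺ʳ)
open import Data.List.Relation.Unary.Any using (Any; here; there)
open import Data.Vec using (Vec; []; _∷_)
import Data.Vec as Vec
open import Data.Product using (Σ; ∃; _×_; _,_; proj₁; proj₂)
open import Relation.Nullary using (¬_; yes; no)
open import Data.Empty using (⊥-elim)
open import Relation.Binary.PropositionalEquality
  using (_≡_; _≢_; refl; sym; trans; cong)

-- Atoms and variables: disjoint countably infinite sets (two copies of ℕ,
-- kept apart by being different types).

𝔸 : Set
𝔸 = ℕ

record 𝕍 : Set where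
  constructor var
  field index : ℕ

record Perm : Set where
  field
    to       : 𝔸 → 𝔸
    from     : 𝔸 → 𝔸
    from∘to  : ∀ a → from (to a) ≡ a
    to∘from  : ∀ a → to (from a) ≡ a
    suppList : List 𝔸
    finite   : ∀ a → to a ≢ a → a ∈ suppList
open Perm public

InDom : Perm → 𝔸 → Set
InDom π a = to π a ≢ a

idPerm : Perm
idPerm = record { to = λ a → a ; from = λ a → a ; from∘to = λ _ → refl
                ; to∘from = λ _ → refl ; suppList = [] ; finite = λ a ne → ⊥-elim (ne refl) }

_∘ₚ_ : Perm → Perm → Perm
π ∘ₚ ρ = record
  { to = λ a → to π (to ρ a)
  ; from = λ a → from ρ (from π a)
  ; from∘to = λ a → trans (cong (from ρ) (from∘to π (to ρ a))) (from∘to ρ a)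
  ; to∘from = λ a → trans (cong (to π) (to∘from ρ (from π a))) (to∘from π a)
  ; suppList = suppList π ++ suppList ρ
  ; finite = fin
  }
  where
    fin : ∀ a → to π (to ρ a) ≢ a → a ∈ (suppList π ++ suppList ρ)
    fin a ne with to ρ a ≟ a
    ... | no  ρa≢a = ∈-++⁺ʳ (suppList π) (finite ρ a ρa≢a)
    ... | yes ρa≡a = ∈-++⁺ˡ (finite π a (λ e → ne (trans (cong (to π) ρa≡a) e)))

_⁻¹ₚ : Perm → Perm
π ⁻¹ₚ = record
  { to = from π ; from = to π ; from∘to = to∘from π ; to∘from = from∘to π
  ; suppList = suppList π
  ; finite = λ a ne → finite π a (λ e → ne (trans (cong (from π) (sym e)) (from∘to π a)))
  }

_^ₚ_ : Perm → Perm → Perm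
π ^ₚ ρ = ρ ∘ₚ (π ∘ₚ (ρ ⁻¹ₚ))

swapFun : 𝔸 → 𝔸 → 𝔸 → 𝔸
swapFun a c x with x ≟ a
... | yes _ = c
... | no _ with x ≟ c
...   | yes _ = a
...   | no _ = x

private
  swap-invol : ∀ a c x → swapFun a c (swapFun a c x) ≡ x
  swap-invol a c x with x ≟ a
  swap-invol a c x | yes x≡a with c ≟ a
  ... | yes c≡a = trans c≡a (sym x≡a)
  ... | no _ with c ≟ c
  ...   | yes _ = sym x≡a
  ...   | no c≢c = ⊥-elim (c≢c refl)
  swap-invol a c x | no x≢a with x ≟ c
  swap-invol a c x | no x≢a | yes x≡c with a ≟ a
  ... | yes _ = sym x≡c
  ... | no a≢a = ⊥-elim (a≢a refl)
  swap-invol a c x | no x≢a | no x≢c with x ≟ a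
  ... | yes x≡a = ⊥-elim (x≢a x≡a)
  ... | no _ with x ≟ c
  ...   | yes x≡c = ⊥-elim (x≢c x≡c)
  ...   | no _ = refl

  swap-fin : ∀ a c x → swapFun a c x ≢ x → x ∈ (a ∷ c ∷ [])
  swap-fin a c x ne with x ≟ a
  ... | yes x≡a = here x≡a
  ... | no _ with x ≟ c
  ...   | yes x≡c = there (here x≡c)
  ...   | no _ = ⊥-elim (ne refl)

swap : 𝔸 → 𝔸 → Perm
swap a c = record
  { to = swapFun a c ; from = swapFun a c
  ; from∘to = swap-invol a c ; to∘from = swap-invol a c
  ; suppList = a ∷ c ∷ [] ; finite = swap-fin a c }

record NominalSet : Set₁ where
  field
    Carrier : Set
    act     : Perm → Carrier → Carrier
    act-ext : ∀ π ρ → (∀ a → to π a ≡ to ρ a) → ∀ x → act π x ≡ act ρ x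
    act-id  : ∀ x → act idPerm x ≡ x
    act-∘   : ∀ π ρ x → act (π ∘ₚ ρ) x ≡ act π (act ρ x)
    finSupp : ∀ x → Σ (List 𝔸) λ S →
                ∀ π → (∀ a → a ∈ S → to π a ≡ a) → act π x ≡ x

record Signature : Set₁ where
  field
    Sym   : Set
    arity : Sym → ℕ
open Signature public

record NominalAlgebra (Σ' : Signature) : Set₁ where
  field
    nset : NominalSet
  open NominalSet nset public
  field
    atom     : 𝔸 → Carrier
    atom-eqv : ∀ π a → atom (to π a) ≡ act π (atom a)
    abs      : 𝔸 → Carrier → Carrier
    abs-eqv  : ∀ π a x → abs (to π a) (act π x) ≡ act π (abs a x)
    abs-fin  : ∀ a x → Σ (List 𝔸) λ L →
                 ∀ c → act (swap a c) (abs a x) ≢ abs a x → c ∈ L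
    fun      : (f : Sym Σ') → Vec Carrier (arity Σ' f) → Carrier
    fun-eqv  : ∀ π f xs → fun f (Vec.map (act π) xs) ≡ act π (fun f xs)

data Term (Σ' : Signature) : Set where
  atmT : 𝔸 → Term Σ'
  susp : Perm → 𝕍 → Term Σ'
  absT : 𝔸 → Term Σ' → Term Σ'
  app  : (f : Sym Σ') → Vec (Term Σ') (arity Σ' f) → Term Σ'

Valuation : ∀ {Σ'} → NominalAlgebra Σ' → Set
Valuation 𝒜 = 𝕍 → NominalAlgebra.Carrier 𝒜

module Interp {Σ' : Signature} (𝒜 : NominalAlgebra Σ') (ς : Valuation 𝒜) where
  open NominalAlgebra 𝒜
  mutual
    ⟦_⟧ : Term Σ' → Carrier
    ⟦ atmT a ⟧   = atom a
    ⟦ susp π X ⟧ = act π (ς X)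
    ⟦ absT a t ⟧ = abs a ⟦ t ⟧
    ⟦ app f ts ⟧ = fun f (⟦_⟧* ts)

    ⟦_⟧* : ∀ {n} → Vec (Term Σ') n → Vec Carrier n
    ⟦ [] ⟧*     = []
    ⟦ t ∷ ts ⟧* = ⟦ t ⟧ ∷ ⟦ ts ⟧*

⟦_⟧⟨_,_⟩ : ∀ {Σ'} → Term Σ' → (𝒜 : NominalAlgebra Σ') → Valuation 𝒜 → NominalAlgebra.Carrier 𝒜
⟦ t ⟧⟨ 𝒜 , ς ⟩ = Interp.⟦_⟧ 𝒜 ς t

record FixConstr : Set where
  constructor _⋏_
  field
    γ : Perm
    X : 𝕍

FPContext : Set
FPContext = List FixConstr

-- a ∈ dom(perm(Υ|X)) = ⋃ {dom γ | γ ⋏ X ∈ Υ}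
InDomPermCtx : FPContext → 𝕍 → 𝔸 → Set
InDomPermCtx Υ X a = Any (λ c → FixConstr.X c ≡ X × InDom (FixConstr.γ c) a) Υ

-- side condition of rule (⋏var) for  Υ ⊢ π ⋏ π'·X :
--   dom(π^{π'⁻¹}) ⊆ dom(perm(Υ|X))
VarRuleCond : FPContext → Perm → Perm → 𝕍 → Set
VarRuleCond Υ π π' X = ∀ a → InDom (π ^ₚ (π' ⁻¹ₚ)) a → InDomPermCtx Υ X a

ValidCtx : ∀ {Σ'} (𝒜 : NominalAlgebra Σ') → Valuation 𝒜 → FPContext → Set
ValidCtx 𝒜 ς Υ = ∀ c → c ∈ Υ →
  NominalAlgebra.act 𝒜 (FixConstr.γ c) (ς (FixConstr.X c)) ≡ ς (FixConstr.X c)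

ValidJudg : ∀ {Σ'} (𝒜 : NominalAlgebra Σ') → Valuation 𝒜 → FPContext → Perm → Term Σ' → Set
ValidJudg 𝒜 ς Υ π t = ValidCtx 𝒜 ς Υ →
  NominalAlgebra.act 𝒜 π ⟦ t ⟧⟨ 𝒜 , ς ⟩ ≡ ⟦ t ⟧⟨ 𝒜 , ς ⟩

{-# OPTIONS --safe #-}
-- The unordered pair {0, 1} is fixed by (0 1) and by (2 3), so it satisfies
-- the context Υ = {(0 1) ⋏ X, (2 3) ⋏ X}, and dom (0 2) = {0, 2} lies inside
-- dom (0 1) ∪ dom (2 3).  Yet (0 2) sends {0, 1} to {1, 2}: being fixed by
-- each γ separately says nothing about permutations supported on the union
-- of their domains.  The unordered pairs have no equivariant element, so a
-- fixed point is adjoined to serve as the value of every term former.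
module Submission where

open import Defs
open import Data.Product using (Σ; _×_; _,_)
open import Data.Sum using (inj₁; inj₂)
open import Relation.Nullary using (¬_)
open import Data.Nat using (_≤_; _⊓_; _⊔_)
open import Data.Nat.Properties
  using (≤-irrelevant; ≤-total; ⊓-comm; ⊔-comm; m⊓n≤m⊔n;
         m≤n⇒m⊓n≡m; m≤n⇒m⊔n≡n; m≥n⇒m⊓n≡n; m≥n⇒m⊔n≡m)
open import Data.Maybe using (Maybe; just; nothing)
import Data.Maybe as Maybe
open import Data.Maybe.Properties using (just-injective; map-cong; map-id; map-∘)
open import Data.List using (List; []; _∷_)
open import Data.List.Membership.Propositional using (_∈_)
open import Data.List.Relation.Unary.Any using (here; there)
open import Data.Empty using (⊥-elim)
open import Relation.Binary.PropositionalEquality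
  using (_≡_; _≢_; refl; sym; trans; cong; cong₂)

-- {a, b} is stored sorted (lo ≤ hi, with a = b allowed); ⟅ a , b ⟆ sorts via ⊓ and ⊔.
record UPair : Set where
  constructor ⟅_,_⟆⟨_⟩
  field
    lo hi : 𝔸
    lo≤hi : lo ≤ hi
open UPair

UPair-≡ : ∀ {p q} → lo p ≡ lo q → hi p ≡ hi q → p ≡ q
UPair-≡ {⟅ _ , _ ⟆⟨ l ⟩} {⟅ _ , _ ⟆⟨ l′ ⟩} refl refl = cong ⟅ _ , _ ⟆⟨_⟩ (≤-irrelevant l l′)

⟅_,_⟆ : 𝔸 → 𝔸 → UPair
⟅ a , b ⟆ = ⟅ a ⊓ b , a ⊔ b ⟆⟨ m⊓n≤m⊔n a b ⟩

⟅⟆-comm : ∀ a b → ⟅ a , b ⟆ ≡ ⟅ b , a ⟆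
⟅⟆-comm a b = UPair-≡ (⊓-comm a b) (⊔-comm a b)

⟅lo,hi⟆ : ∀ p → ⟅ lo p , hi p ⟆ ≡ p
⟅lo,hi⟆ p = UPair-≡ (m≤n⇒m⊓n≡m (lo≤hi p)) (m≤n⇒m⊔n≡n (lo≤hi p))

⟅⟆-map-⊓⊔ : ∀ (f : 𝔸 → 𝔸) a b → ⟅ f (a ⊓ b) , f (a ⊔ b) ⟆ ≡ ⟅ f a , f b ⟆
⟅⟆-map-⊓⊔ f a b with ≤-total a b
... | inj₁ a≤b = cong₂ (λ x y → ⟅ f x , f y ⟆) (m≤n⇒m⊓n≡m a≤b) (m≤n⇒m⊔n≡n a≤b)
... | inj₂ b≤a = trans (cong₂ (λ x y → ⟅ f x , f y ⟆) (m≥n⇒m⊓n≡n b≤a) (m≥n⇒m⊔n≡m b≤a))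
                       (⟅⟆-comm (f b) (f a))

permute : Perm → UPair → UPair
permute π p = ⟅ to π (lo p) , to π (hi p) ⟆

permute-⟅⟆ : ∀ π a b → permute π ⟅ a , b ⟆ ≡ ⟅ to π a , to π b ⟆
permute-⟅⟆ π = ⟅⟆-map-⊓⊔ (to π)

UPairs : NominalSet
UPairs = record
  { Carrier = UPair
  ; act     = permute
  ; act-ext = λ π ρ π≗ρ p → cong₂ ⟅_,_⟆ (π≗ρ (lo p)) (π≗ρ (hi p))
  ; act-id  = ⟅lo,hi⟆
  ; act-∘   = λ π ρ p → sym (permute-⟅⟆ π (to ρ (lo p)) (to ρ (hi p)))
  ; finSupp = λ p → lo p ∷ hi p ∷ [] , λ π fix →
      trans (cong₂ ⟅_,_⟆ (fix (lo p) (here refl)) (fix (hi p) (there (here refl))))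
            (⟅lo,hi⟆ p)
  }

_⁺ : NominalSet → NominalSet
N ⁺ = record
  { Carrier = Maybe Carrier
  ; act     = λ π → Maybe.map (act π)
  ; act-ext = λ π ρ π≗ρ → map-cong (act-ext π ρ π≗ρ)
  ; act-id  = λ x → trans (map-cong act-id x) (map-id x)
  ; act-∘   = λ π ρ x → trans (map-cong (act-∘ π ρ) x) (map-∘ x)
  ; finSupp = finSupp⁺
  }
  where
    open NominalSet N
    finSupp⁺ : ∀ x → Σ (List 𝔸) λ S →
                 ∀ π → (∀ a → a ∈ S → to π a ≡ a) → Maybe.map (act π) x ≡ x
    finSupp⁺ nothing  = [] , λ _ _ → refl
    finSupp⁺ (just x) with finSupp x
    ... | S , fixes = S , λ π fix → cong just (fixes π fix)

constAlgebra : (Σ' : Signature) (N : NominalSet) (e : NominalSet.Carrier N) →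
               (∀ π → NominalSet.act N π e ≡ e) → NominalAlgebra Σ'
constAlgebra Σ' N e e-fixed = record
  { nset     = N
  ; atom     = λ _ → e
  ; atom-eqv = λ π _ → sym (e-fixed π)
  ; abs      = λ _ _ → e
  ; abs-eqv  = λ π _ _ → sym (e-fixed π)
  ; abs-fin  = λ a _ → [] , λ c moved → ⊥-elim (moved (e-fixed (swap a c)))
  ; fun      = λ _ _ → e
  ; fun-eqv  = λ π _ _ → sym (e-fixed π)
  }

UPairAlgebra : (Σ' : Signature) → NominalAlgebra Σ'
UPairAlgebra Σ' = constAlgebra Σ' (UPairs ⁺) nothing (λ _ → refl)

⟅0,1⟆-fixed-by-⟨01⟩ : permute (swap 0 1) ⟅ 0 , 1 ⟆ ≡ ⟅ 0 , 1 ⟆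
⟅0,1⟆-fixed-by-⟨01⟩ = ⟅⟆-comm 1 0

⟅0,1⟆-fixed-by-⟨23⟩ : permute (swap 2 3) ⟅ 0 , 1 ⟆ ≡ ⟅ 0 , 1 ⟆
⟅0,1⟆-fixed-by-⟨23⟩ = refl

⟅0,1⟆-moved-by-⟨02⟩ : permute (swap 0 2) ⟅ 0 , 1 ⟆ ≢ ⟅ 0 , 1 ⟆
⟅0,1⟆-moved-by-⟨02⟩ e with cong lo e
... | ()

Υ₀₁₂₃ : 𝕍 → FPContext
Υ₀₁₂₃ X = (swap 0 1 ⋏ X) ∷ (swap 2 3 ⋏ X) ∷ []

dom⟨02⟩⊆dom-Υ₀₁₂₃ : ∀ X → VarRuleCond (Υ₀₁₂₃ X) (swap 0 2) idPerm X
dom⟨02⟩⊆dom-Υ₀₁₂₃ X a a-moved with finite (swap 0 2) a a-moved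
... | here refl         = here (refl , λ ())
... | there (here refl) = there (here (refl , λ ()))

claim3p14 : (Σ' : Signature) →
    Σ (NominalAlgebra Σ') λ 𝒜 → Σ (Valuation 𝒜) λ ς → Σ FPContext λ Υ →
    Σ Perm λ π → Σ Perm λ π' → Σ 𝕍 λ X →
      VarRuleCond Υ π π' X × ¬ ValidJudg 𝒜 ς Υ π (susp π' X)
claim3p14 Σ' = UPairAlgebra Σ' , ς , Υ₀₁₂₃ X , swap 0 2 , idPerm , X
             , dom⟨02⟩⊆dom-Υ₀₁₂₃ X , unsound
  where
    X = var 0
    ς : Valuation (UPairAlgebra Σ')
    ς _ = just ⟅ 0 , 1 ⟆

    Υ-valid : ValidCtx (UPairAlgebra Σ') ς (Υ₀₁₂₃ X)
    Υ-valid _ (here refl)         = cong just ⟅0,1⟆-fixed-by-⟨01⟩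
    Υ-valid _ (there (here refl)) = cong just ⟅0,1⟆-fixed-by-⟨23⟩

    unsound : ¬ ValidJudg (UPairAlgebra Σ') ς (Υ₀₁₂₃ X) (swap 0 2) (susp idPerm X)
    unsound valid = ⟅0,1⟆-moved-by-⟨02⟩ (just-injective (valid Υ-valid))
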